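{- Let $G$ be the complement of a cycle of length at least five. Then $G$ is not a $2$-cograph, but every proper induced subgraph of $G$ is a $2$-cograph.
   Context: All graphs are finite and simple; $\overline{G}$ denotes the complement of $G$. A graph is $2$-connected if it has at least three vertices, is connected, and has no cut vertex. A graph $G$ is a $2$-cograph if $G$ has no induced subgraph $H$ such that both $H$ and $\overline{H}$ are $2$-connected. -}

module Defs where

open import Data.Nat using (ℕ; zero; suc; _≤_)
open import Data.Fin using (Fin; toℕ; punchIn)
open import Data.Product using (_×_)
open import Data.Sum using (_⊎_)
open import Data.Empty using (⊥)
open import Relation.Nullary using (¬_)
open import Relation.Binary.PropositionalEquality using (_≡_; _≢_)
open import Relation.Binary.Construct.Closure.ReflexiveTransitive using (Star)
open import Function.Definitions using (Injective)

record Graph (n : ℕ) : Set₁ where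
  field
    Adj : Fin n → Fin n → Set
open Graph public

complement : ∀ {n} → Graph n → Graph n
Adj (complement G) i j = (i ≢ j) × ¬ Adj G i j

induced : ∀ {n m} → Graph n → (Fin m → Fin n) → Graph m
Adj (induced G f) i j = Adj G (f i) (f j)

delete : ∀ {n} → Graph (suc n) → Fin (suc n) → Graph n
delete G v = induced G (punchIn v)

cycle : (k : ℕ) → Graph k
Adj (cycle k) i j =
  (toℕ j ≡ suc (toℕ i)) ⊎ (toℕ i ≡ suc (toℕ j)) ⊎
  ((toℕ i ≡ 0) × (suc (toℕ j) ≡ k)) ⊎ ((toℕ j ≡ 0) × (suc (toℕ i) ≡ k))

Connected : ∀ {n} → Graph n → Set
Connected G = ∀ u v → Star (Adj G) u v

TwoConnected : ∀ {n} → Graph n → Set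
TwoConnected {zero} G = ⊥
TwoConnected {suc n} G =
  (3 ≤ suc n) × Connected G × (∀ v → Connected (delete G v))

Is2Cograph : ∀ {n} → Graph n → Set
Is2Cograph {n} G =
  ∀ (m : ℕ) (f : Fin m → Fin n) → Injective _≡_ _≡_ f →
  ¬ (TwoConnected (induced G f) × TwoConnected (complement (induced G f)))

-- C̄_k (k ≥ 5) and its complement C_k are both 2-connected: C_k − v is a path, and in C̄_k − v
-- every vertex reaches the successor of v within two steps. Conversely, a proper induced subgraph
-- misses some vertex w, so the complement of any induced subgraph H of it is a subgraph of the
-- path C_k − w. Numbering that path gives H̄ an injective height that rises by at most one along
-- every edge, and then among any three vertices of H̄ the one of middle height is a cut vertex.

module Submission where

open import Defs
open import Data.Nat
  using (ℕ; zero; suc; _+_; _≤_; _<_; _≤′_; ≤′-refl; ≤′-step; z≤n; s≤s; z<s; _<?_; _≟_)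
open import Data.Nat.Properties
open import Data.Fin using (Fin; zero; suc; toℕ; fromℕ<; punchIn; punchOut)
import Data.Fin.Properties as Fin
open import Data.Product using (_×_; _,_; proj₁; proj₂; ∃; ∃₂)
open import Data.Sum using (_⊎_; inj₁; inj₂; [_,_]′)
open import Function using (id; _∘_)
open import Function.Definitions using (Injective)
open import Relation.Nullary using (¬_; yes; no; contradiction)
open import Relation.Nullary.Decidable using (¬?; _×-dec_; _⊎-dec_; decidable-stable)
open import Relation.Binary using (Symmetric; Decidable; tri<; tri≈; tri>)
open import Relation.Binary.PropositionalEquality
open import Relation.Binary.Construct.Closure.ReflexiveTransitive

complement-symmetric : ∀ {n} {G : Graph n} → Symmetric (Adj G) → Symmetric (Adj (complement G))
complement-symmetric G-sym (x≢y , ¬xy) = x≢y ∘ sym , ¬xy ∘ G-sym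

⊆-complement² : ∀ {n} {G : Graph n} → (∀ {x} → ¬ Adj G x x) →
                ∀ {x y} → Adj G x y → Adj (complement (complement G)) x y
⊆-complement² irrefl xy = (λ { refl → irrefl xy }) , λ (_ , ¬xy) → ¬xy xy

complement²-induced⇒ : ∀ {n m} {G : Graph n} {h : Fin m → Fin n} → Injective _≡_ _≡_ h →
  Decidable (Adj G) → ∀ {i j} → Adj (complement (induced (complement G) h)) i j → Adj G (h i) (h j)
complement²-induced⇒ {h = h} h-inj G? {i} {j} (i≢j , ¬co) =
  decidable-stable (G? (h i) (h j)) (λ ¬adj → ¬co (i≢j ∘ h-inj , ¬adj))

TwoConnected-mono : ∀ {n} {G H : Graph n} → (∀ {x y} → Adj G x y → Adj H x y) →
                    TwoConnected G → TwoConnected H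
TwoConnected-mono {zero} G⊆H ()
TwoConnected-mono {suc n} G⊆H (3≤n , conn , conn-del) =
  3≤n , (λ x y → gmap id G⊆H (conn x y)) , (λ v x y → gmap id G⊆H (conn-del v x y))

connected-from-delete : ∀ {n} (G : Graph (suc n)) {v u} → Symmetric (Adj G) → v ≢ u → Adj G v u →
                        Connected (delete G v) → Connected G
connected-from-delete G {v} {u} G-sym v≢u vu conn x y = to-u x ◅◅ reverse G-sym (to-u y)
  where
  to-u : ∀ x → Star (Adj G) x u
  to-u x with v Fin.≟ x
  ... | yes refl = vu ◅ ε
  ... | no v≢x = subst₂ (Star (Adj G)) (Fin.punchIn-punchOut v≢x) (Fin.punchIn-punchOut v≢u)
                   (gmap (punchIn v) id (conn (punchOut v≢x) (punchOut v≢u)))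

injection-misses : ∀ {m k} (f : Fin m → Fin k) → Injective _≡_ _≡_ f → m < k → ∃ λ w → ∀ i → f i ≢ w
injection-misses {m} {k} f f-inj m<k with Fin.any? (λ w → Fin.all? (λ i → ¬? (f i Fin.≟ w)))
... | yes missed = missed
... | no ¬missed = contradiction (Fin.injective⇒≤ preimage-injective) (<⇒≱ m<k)
  where
  preimage : ∀ w → ∃ λ i → f i ≡ w
  preimage w with i , ¬fi≢w ← Fin.¬∀⟶∃¬ m _ (λ i → ¬? (f i Fin.≟ w)) (¬missed ∘ (w ,_)) =
    i , decidable-stable (f i Fin.≟ w) ¬fi≢w
  preimage-injective : Injective _≡_ _≡_ (proj₁ ∘ preimage)
  preimage-injective {x} {y} e =
    trans (sym (proj₂ (preimage x))) (trans (cong f e) (proj₂ (preimage y)))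

-- Graphs whose adjacency is a relation R on the labels toℕ x: G − v is then
-- R restricted to the labels {0, …, k−1} ∖ {toℕ v}, and walks in it can be built in ℕ.

Present : ℕ → ℕ → ℕ → Set
Present k V a = a < k × a ≢ V

Restrict : (ℕ → ℕ → Set) → ℕ → ℕ → ℕ → ℕ → Set
Restrict R k V a b = Present k V a × Present k V b × R a b

Restrict-sym : ∀ {R k V} → Symmetric R → Symmetric (Restrict R k V)
Restrict-sym R-sym (pa , pb , r) = pb , pa , R-sym r

Reaches : (ℕ → ℕ → Set) → ℕ → ℕ → ℕ → Set
Reaches R k V r = ∀ {a} → Present k V a → Star (Restrict R k V) a r

module _ {n} (G : Graph (suc n)) {R : ℕ → ℕ → Set}
         (R⇒Adj : ∀ {x y} → R (toℕ x) (toℕ y) → Adj G x y) (v : Fin (suc n)) where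

  walk-in-delete : ∀ {a b} → Star (Restrict R (suc n) (toℕ v)) a b →
                   ∀ x y → toℕ (punchIn v x) ≡ a → toℕ (punchIn v y) ≡ b → Star (Adj (delete G v)) x y
  walk-in-delete ε x y refl y≡x =
    subst (Star _ x) (Fin.punchIn-injective v x y (Fin.toℕ-injective (sym y≡x))) ε
  walk-in-delete (_◅_ {j = c} (_ , (c<k , c≢v) , r) w) x y refl y≡b =
    R⇒Adj (subst (R _) (sym z≡c) r) ◅ walk-in-delete w z y z≡c y≡b
    where
    v≢c : v ≢ fromℕ< c<k
    v≢c v≡c = c≢v (trans (sym (Fin.toℕ-fromℕ< c<k)) (cong toℕ (sym v≡c)))
    z : Fin n
    z = punchOut v≢c
    z≡c : toℕ (punchIn v z) ≡ c
    z≡c = trans (cong toℕ (Fin.punchIn-punchOut v≢c)) (Fin.toℕ-fromℕ< c<k)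

  delete-connected : Symmetric R → ∀ {V} → toℕ v ≡ V → ∀ {r} → Reaches R (suc n) V r →
                     Connected (delete G v)
  delete-connected R-sym refl reach x y =
    walk-in-delete (reach (present x) ◅◅ reverse (Restrict-sym R-sym) (reach (present y))) x y refl refl
    where
    present : ∀ x → Present (suc n) (toℕ v) (toℕ (punchIn v x))
    present x = Fin.toℕ<n _ , Fin.punchInᵢ≢i v x ∘ Fin.toℕ-injective

ascending : ∀ {R : ℕ → ℕ → Set} {a b} → (∀ {i} → a ≤ i → i < b → R i (suc i)) → a ≤ b → Star R a b
ascending {R = R} {a} step a≤b = go step (≤⇒≤′ a≤b)
  where
  go : ∀ {b} → (∀ {i} → a ≤ i → i < b → R i (suc i)) → a ≤′ b → Star R a b
  go step ≤′-refl = ε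
  go step (≤′-step a≤′b) =
    go (λ a≤i i<b → step a≤i (m<n⇒m<1+n i<b)) a≤′b ◅◅ step (≤′⇒≤ a≤′b) ≤-refl ◅ ε

CycleAdj : ℕ → ℕ → ℕ → Set
CycleAdj k i j = (j ≡ suc i) ⊎ (i ≡ suc j) ⊎ ((i ≡ 0) × (suc j ≡ k)) ⊎ ((j ≡ 0) × (suc i ≡ k))

cycleAdj? : ∀ k → Decidable (CycleAdj k)
cycleAdj? k i j =
  (j ≟ suc i) ⊎-dec (i ≟ suc j) ⊎-dec ((i ≟ 0) ×-dec (suc j ≟ k)) ⊎-dec ((j ≟ 0) ×-dec (suc i ≟ k))

cycleAdj-sym : ∀ {k} → Symmetric (CycleAdj k)
cycleAdj-sym (inj₁ e) = inj₂ (inj₁ e)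
cycleAdj-sym (inj₂ (inj₁ e)) = inj₁ e
cycleAdj-sym (inj₂ (inj₂ (inj₁ p))) = inj₂ (inj₂ (inj₂ p))
cycleAdj-sym (inj₂ (inj₂ (inj₂ p))) = inj₂ (inj₂ (inj₁ p))

cycleAdj-irrefl : ∀ {n i} → ¬ CycleAdj (suc (suc n)) i i
cycleAdj-irrefl (inj₁ e) = 1+n≢n (sym e)
cycleAdj-irrefl (inj₂ (inj₁ e)) = 1+n≢n (sym e)
cycleAdj-irrefl (inj₂ (inj₂ (inj₁ (refl , ()))))
cycleAdj-irrefl (inj₂ (inj₂ (inj₂ (refl , ()))))

ascending-cycle-path : ∀ {k V a b} → (∀ {i} → a ≤ i → i ≤ b → Present k V i) → a ≤ b →
                       Star (Restrict (CycleAdj k) k V) a b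
ascending-cycle-path present =
  ascending (λ a≤i i<b → present a≤i (<⇒≤ i<b) , present (m≤n⇒m≤1+n a≤i) i<b , inj₁ refl)

cycle-reaches-last : ∀ {n} → Reaches (CycleAdj (suc n)) (suc n) 0 n
cycle-reaches-last (a<k , a≢0) =
  ascending-cycle-path (λ a≤i i≤n → s≤s i≤n , λ { refl → a≢0 (n≤0⇒n≡0 a≤i) }) (≤-pred a<k)

cycle-reaches-zero : ∀ {n V} → Reaches (CycleAdj (suc n)) (suc n) (suc V) 0
cycle-reaches-zero {n} {V} {a} (a<k , a≢V) with <-cmp a (suc V)
... | tri< a<V _ _ = reverse (Restrict-sym cycleAdj-sym)
        (ascending-cycle-path (λ _ i≤a → ≤-<-trans i≤a a<k , <⇒≢ (≤-<-trans i≤a a<V)) z≤n)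
... | tri≈ _ a≡V _ = contradiction a≡V a≢V
... | tri> _ _ V<a =
        ascending-cycle-path (λ a≤i i≤n → s≤s i≤n , >⇒≢ (<-≤-trans V<a a≤i)) (≤-pred a<k)
          ◅◅ wrap ◅ ε
  where
  wrap : Restrict (CycleAdj (suc n)) (suc n) (suc V) n 0
  wrap = (≤-refl , >⇒≢ (<-≤-trans V<a (≤-pred a<k))) , (s≤s z≤n , λ ()) ,
         inj₂ (inj₂ (inj₂ (refl , refl)))

cycle-delete-connected : ∀ n (v : Fin (suc n)) → Connected (delete (cycle (suc n)) v)
cycle-delete-connected n v with toℕ v in v≡V
... | zero = delete-connected (cycle (suc n)) id v cycleAdj-sym v≡V cycle-reaches-last
... | suc _ = delete-connected (cycle (suc n)) id v cycleAdj-sym v≡V cycle-reaches-zero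

CoCycleAdj : ℕ → ℕ → ℕ → Set
CoCycleAdj k a b = a ≢ b × ¬ CycleAdj k a b

coCycleAdj-sym : ∀ {k} → Symmetric (CoCycleAdj k)
coCycleAdj-sym (a≢b , ¬ab) = a≢b ∘ sym , ¬ab ∘ cycleAdj-sym

coCycleAdj⇒Adj : ∀ {k} {x y : Fin k} → CoCycleAdj k (toℕ x) (toℕ y) → Adj (complement (cycle k)) x y
coCycleAdj⇒Adj (x≢y , ¬xy) = x≢y ∘ cong toℕ , ¬xy

coCycleAdj-apart : ∀ {k a b} → 2 + a ≤ b → 0 < a ⊎ suc b < k → CoCycleAdj k a b
coCycleAdj-apart {k} {a} {b} a+2≤b ends = <⇒≢ a<b , ¬adj
  where
  a<b : a < b
  a<b = ≤-trans (n≤1+n _) a+2≤b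
  ¬adj : ¬ CycleAdj k a b
  ¬adj (inj₁ b≡1+a) = <⇒≢ a+2≤b (sym b≡1+a)
  ¬adj (inj₂ (inj₁ a≡1+b)) = <-asym a<b (≤-reflexive (sym a≡1+b))
  ¬adj (inj₂ (inj₂ (inj₁ (a≡0 , 1+b≡k)))) =
    [ (λ 0<a → <⇒≢ 0<a (sym a≡0)) , (λ 1+b<k → <⇒≢ 1+b<k 1+b≡k) ]′ ends
  ¬adj (inj₂ (inj₂ (inj₂ (b≡0 , _)))) = contradiction (subst (2 + a ≤_) b≡0 a+2≤b) λ ()

zero-or-end : ∀ u {b k} → (u ≡ 0 → suc b < k) → 0 < u ⊎ suc b < k
zero-or-end zero end = inj₂ (end refl)
zero-or-end (suc u) _ = inj₁ z<s

module _ {k V : ℕ} where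

  hop-up : ∀ {a b} → Present k V a → Present k V b → 2 + a ≤ b → 0 < a ⊎ suc b < k →
           Restrict (CoCycleAdj k) k V a b
  hop-up pa pb a+2≤b ends = pa , pb , coCycleAdj-apart a+2≤b ends

  hop-down : ∀ {a b} → Present k V a → Present k V b → 2 + a ≤ b → 0 < a ⊎ suc b < k →
             Restrict (CoCycleAdj k) k V b a
  hop-down pa pb a+2≤b ends = Restrict-sym coCycleAdj-sym (hop-up pa pb a+2≤b ends)

-- In C̄_k − u (k ≥ 5) every vertex reaches u + 1 (mod k) in at most two hops; the vertices
-- not adjacent to u + 1 take the detour through u − 1.

coCycle-reaches-one : ∀ m → Reaches (CoCycleAdj (5 + m)) (5 + m) 0 1
coCycle-reaches-one m {0} (_ , 0≢0) = contradiction refl 0≢0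
coCycle-reaches-one m {1} _ = ε
coCycle-reaches-one m {2} p2 =
  hop-up p2 pk-1 (m≤m+n 4 m) (inj₁ z<s) ◅ hop-down p1 pk-1 (m≤m+n 3 (suc m)) (inj₁ z<s) ◅ ε
  where
  p1 : Present (5 + m) 0 1
  p1 = s≤s (s≤s z≤n) , λ ()
  pk-1 : Present (5 + m) 0 (4 + m)
  pk-1 = ≤-refl , λ ()
coCycle-reaches-one m {suc (suc (suc a))} pa =
  hop-down (s≤s (s≤s z≤n) , λ ()) pa (s≤s (s≤s (s≤s z≤n))) (inj₁ z<s) ◅ ε

coCycle-reaches-zero : ∀ m → Reaches (CoCycleAdj (5 + m)) (5 + m) (4 + m) 0
coCycle-reaches-zero m {0} _ = ε
coCycle-reaches-zero m {1} p1 =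
  hop-up p1 pk-2 (m≤m+n 3 m) (inj₁ z<s) ◅ hop-down p0 pk-2 (m≤m+n 2 (suc m)) (inj₂ (n<1+n _)) ◅ ε
  where
  p0 : Present (5 + m) (4 + m) 0
  p0 = z<s , λ ()
  pk-2 : Present (5 + m) (4 + m) (3 + m)
  pk-2 = m<n⇒m<1+n ≤-refl , 1+n≢n ∘ sym
coCycle-reaches-zero m {suc (suc a)} pa@(a<k , a≢k-1) =
  hop-down (z<s , λ ()) pa (s≤s (s≤s z≤n)) (inj₂ (s≤s (≤∧≢⇒< (≤-pred a<k) a≢k-1))) ◅ ε

module _ (m u : ℕ) (v<k-1 : suc u < 4 + m) where
  private
    pu : Present (5 + m) (suc u) u
    pu = <-trans (n<1+n u) (m<n⇒m<1+n v<k-1) , <⇒≢ (n<1+n u)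
    pnext : Present (5 + m) (suc u) (2 + u)
    pnext = s≤s v<k-1 , 1+n≢n

    below : ∀ {a} → Present (5 + m) (suc u) a → a ≤ u →
            Star (Restrict (CoCycleAdj (5 + m)) (5 + m) (suc u)) a (2 + u)
    below {suc a} pa a≤u = hop-up pa pnext (s≤s (s≤s a≤u)) (inj₁ z<s) ◅ ε
    below {zero} p0 _ with 3 + u <? 5 + m
    ... | yes next<k-1 = hop-up p0 pnext (s≤s (s≤s z≤n)) (inj₂ next<k-1) ◅ ε
    ... | no next≮k-1 =
      hop-up p0 pu 2≤u (inj₂ (s≤s (<⇒≤ v<k-1))) ◅
      hop-up pu pnext ≤-refl (inj₁ (≤-trans (s≤s z≤n) 2≤u)) ◅ ε
      where
      2≤u : 2 ≤ u
      2≤u = ≤-pred (≤-pred (≤-pred (≤-trans (s≤s (s≤s (s≤s (m≤m+n 2 m)))) (≮⇒≥ next≮k-1))))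

  coCycle-reaches-next : Reaches (CoCycleAdj (5 + m)) (5 + m) (suc u) (2 + u)
  coCycle-reaches-next {a} pa@(a<k , a≢v) with <-cmp a (suc u)
  ... | tri≈ _ a≡v _ = contradiction a≡v a≢v
  ... | tri< (s≤s a≤u) _ _ = below pa a≤u
  ... | tri> _ _ v<a with a ≟ 2 + u | a ≟ 3 + u
  ...   | yes refl | _ = ε
  ...   | no _ | yes refl =
    hop-down pu pa (n≤1+n _) (zero-or-end u λ { refl → s≤s (s≤s (s≤s (s≤s (s≤s z≤n)))) }) ◅
    hop-up pu pnext ≤-refl (zero-or-end u λ { refl → s≤s (s≤s (s≤s (s≤s z≤n))) }) ◅ ε
  ...   | no a≢next | no a≢next+1 = hop-down pnext pa 4+u≤a (inj₁ z<s) ◅ ε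
    where
    4+u≤a : 4 + u ≤ a
    4+u≤a = ≤∧≢⇒< (≤∧≢⇒< v<a (a≢next ∘ sym)) (a≢next+1 ∘ sym)

coCycle-delete-connected : ∀ m (v : Fin (5 + m)) → Connected (delete (complement (cycle (5 + m))) v)
coCycle-delete-connected m v with toℕ v in v≡u
... | zero = delete-connected _ coCycleAdj⇒Adj v coCycleAdj-sym v≡u (coCycle-reaches-one m)
... | suc u with suc u ≟ 4 + m
...   | yes refl = delete-connected _ coCycleAdj⇒Adj v coCycleAdj-sym v≡u (coCycle-reaches-zero m)
...   | no v≢k-1 =
  delete-connected _ coCycleAdj⇒Adj v coCycleAdj-sym v≡u (coCycle-reaches-next m u v<k-1)
  where
  v<k-1 : suc u < 4 + m
  v<k-1 = ≤∧≢⇒< (≤-pred (subst (_< 5 + m) v≡u (Fin.toℕ<n v))) v≢k-1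

cycle-TwoConnected : ∀ m → TwoConnected (cycle (3 + m))
cycle-TwoConnected m =
  s≤s (s≤s (s≤s z≤n)) ,
  connected-from-delete (cycle (3 + m)) {zero} {suc zero} cycleAdj-sym (λ ()) (inj₁ refl)
    (cycle-delete-connected (2 + m) zero) ,
  cycle-delete-connected (2 + m)

coCycle-TwoConnected : ∀ m → TwoConnected (complement (cycle (5 + m)))
coCycle-TwoConnected m =
  s≤s (s≤s (s≤s z≤n)) ,
  connected-from-delete (complement (cycle (5 + m))) {zero} {suc (suc zero)}
    (complement-symmetric cycleAdj-sym) (λ ())
    (coCycleAdj⇒Adj (coCycleAdj-apart ≤-refl (inj₂ (s≤s (s≤s (s≤s (s≤s z≤n)))))))
    (coCycle-delete-connected m zero) ,
  coCycle-delete-connected m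

walk-stays-below : ∀ {A : Set} {R : A → A → Set} (q : A → ℕ) {t} →
                   (∀ {x y} → R x y → q y ≤ suc (q x)) → (∀ x → q x ≢ t) →
                   ∀ {x y} → Star R x y → q x < t → q y < t
walk-stays-below q rise miss ε qx<t = qx<t
walk-stays-below q rise miss (r ◅ w) qx<t =
  walk-stays-below q rise miss w (≤∧≢⇒< (≤-trans (rise r) qx<t) (miss _))

one-strictly-between : ∀ {A : Set} (q : A → ℕ) → Injective _≡_ _≡_ q → (x y z : A) →
                       x ≢ y → y ≢ z → x ≢ z → ∃₂ λ a b → ∃ λ c → q a < q c × q c < q b
one-strictly-between q q-inj x y z x≢y y≢z x≢z
  with <-cmp (q x) (q y) | <-cmp (q y) (q z) | <-cmp (q x) (q z)
... | tri≈ _ e _ | _ | _ = contradiction (q-inj e) x≢y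
... | _ | tri≈ _ e _ | _ = contradiction (q-inj e) y≢z
... | _ | _ | tri≈ _ e _ = contradiction (q-inj e) x≢z
... | tri< x<y _ _ | tri< y<z _ _ | _ = x , z , y , x<y , y<z
... | tri< x<y _ _ | tri> _ _ z<y | tri< x<z _ _ = x , y , z , x<z , z<y
... | tri< x<y _ _ | tri> _ _ z<y | tri> _ _ z<x = z , y , x , z<x , x<y
... | tri> _ _ y<x | tri< y<z _ _ | tri< x<z _ _ = y , z , x , y<x , x<z
... | tri> _ _ y<x | tri< y<z _ _ | tri> _ _ z<x = y , x , z , y<z , z<x
... | tri> _ _ y<x | tri> _ _ z<y | _ = z , x , y , z<y , y<x

-- A vertex c whose height lies strictly between those of a and b is a cut vertex: a walk from a
-- rises by at most one per step and avoids height q c, so it never gets above q c.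
unit-rise⇒¬TwoConnected : ∀ {n} (G : Graph n) (q : Fin n → ℕ) → Injective _≡_ _≡_ q →
                          (∀ {x y} → Adj G x y → q y ≤ suc (q x)) → ¬ TwoConnected G
unit-rise⇒¬TwoConnected {zero} G q q-inj rise ()
unit-rise⇒¬TwoConnected {1} G q q-inj rise (s≤s () , _)
unit-rise⇒¬TwoConnected {2} G q q-inj rise (s≤s (s≤s ()) , _)
unit-rise⇒¬TwoConnected {suc (suc (suc _))} G q q-inj rise (_ , _ , conn-del)
  with a , b , c , qa<qc , qc<qb ←
         one-strictly-between q q-inj zero (suc zero) (suc (suc zero)) (λ ()) (λ ()) (λ ())
  = <-asym qc<qb (subst (_< q c) (cong q (Fin.punchIn-punchOut c≢b)) qb<qc)
  where
  c≢a : c ≢ a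
  c≢a c≡a = <⇒≢ qa<qc (cong q (sym c≡a))
  c≢b : c ≢ b
  c≢b c≡b = <⇒≢ qc<qb (cong q c≡b)
  qb<qc : q (punchIn c (punchOut c≢b)) < q c
  qb<qc = walk-stays-below (q ∘ punchIn c) rise (λ x e → Fin.punchInᵢ≢i c x (q-inj e))
            (conn-del c (punchOut c≢a) (punchOut c≢b))
            (subst (_< q c) (sym (cong q (Fin.punchIn-punchOut c≢a))) qa<qc)

-- Position of label x on the path C_k − w traversed as w + 1, …, k − 1, 0, …, w − 1.
unroll : ℕ → ℕ → ℕ → ℕ
unroll k w x with w <? x
... | yes _ = x
... | no _ = x + k

unroll-injective : ∀ {k w x y} → x < k → y < k → unroll k w x ≡ unroll k w y → x ≡ y
unroll-injective {k} {w} {x} {y} x<k y<k e with w <? x | w <? y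
... | yes _ | yes _ = e
... | no _ | no _ = +-cancelʳ-≡ k x y e
... | yes _ | no _ = contradiction (subst (k ≤_) (sym e) (m≤n+m k y)) (<⇒≱ x<k)
... | no _ | yes _ = contradiction (subst (k ≤_) e (m≤n+m k x)) (<⇒≱ y<k)

cycleAdj-rise : ∀ {k x y} → CycleAdj k x y → y ≤ suc x ⊎ (x ≡ 0 × suc y ≡ k)
cycleAdj-rise (inj₁ y≡1+x) = inj₁ (≤-reflexive y≡1+x)
cycleAdj-rise (inj₂ (inj₁ x≡1+y)) = inj₁ (m≤n⇒m≤1+n (<⇒≤ (≤-reflexive (sym x≡1+y))))
cycleAdj-rise (inj₂ (inj₂ (inj₁ wrap))) = inj₂ wrap
cycleAdj-rise (inj₂ (inj₂ (inj₂ (refl , _)))) = inj₁ z≤n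

unroll-rise : ∀ {k w x y} → w < k → y < k → w ≢ y → CycleAdj k x y →
              unroll k w y ≤ suc (unroll k w x)
unroll-rise {k} {w} {x} {y} w<k y<k w≢y adj with w <? x | w <? y
... | no _ | yes _ = ≤-trans (<⇒≤ y<k) (≤-trans (m≤n+m k x) (n≤1+n _))
... | yes w<x | yes _ =
  [ id , (λ (x≡0 , _) → contradiction (subst (w <_) x≡0 w<x) λ ()) ]′ (cycleAdj-rise adj)
... | no _ | no w≮y with cycleAdj-rise adj
...   | inj₁ y≤1+x = +-monoˡ-≤ k y≤1+x
...   | inj₂ (_ , 1+y≡k) =
  contradiction (≤-antisym (≤-pred (subst (w <_) (sym 1+y≡k) w<k)) (≮⇒≥ w≮y)) w≢y
unroll-rise {k} {w} w<k y<k w≢y adj | yes w<x | no w≮y with adj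
...   | inj₁ y≡1+x = contradiction (≤-reflexive (sym y≡1+x)) (<-asym (≤-<-trans (≮⇒≥ w≮y) w<x))
...   | inj₂ (inj₁ x≡1+y) =
  contradiction (≤-pred (subst (w <_) x≡1+y w<x)) (<⇒≱ (≤∧≢⇒< (≮⇒≥ w≮y) (w≢y ∘ sym)))
...   | inj₂ (inj₂ (inj₁ (x≡0 , _))) = contradiction (subst (w <_) x≡0 w<x) λ ()
...   | inj₂ (inj₂ (inj₂ (y≡0 , 1+x≡k))) = ≤-reflexive (trans (cong (_+ k) y≡0) (sym 1+x≡k))

complement-induced-coCycle-¬TwoConnected : ∀ {k m} (h : Fin m → Fin k) → Injective _≡_ _≡_ h →
  (w : Fin k) → (∀ i → h i ≢ w) → ¬ TwoConnected (complement (induced (complement (cycle k)) h))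
complement-induced-coCycle-¬TwoConnected {k} {m} h h-inj w missed =
  unit-rise⇒¬TwoConnected _ height height-injective rise
  where
  height : Fin m → ℕ
  height i = unroll k (toℕ w) (toℕ (h i))
  height-injective : Injective _≡_ _≡_ height
  height-injective e = h-inj (Fin.toℕ-injective (unroll-injective (Fin.toℕ<n _) (Fin.toℕ<n _) e))
  w≢h : ∀ i → toℕ w ≢ toℕ (h i)
  w≢h i e = missed i (Fin.toℕ-injective (sym e))
  rise : ∀ {i j} → Adj (complement (induced (complement (cycle k)) h)) i j → height j ≤ suc (height i)
  rise {j = j} adj = unroll-rise (Fin.toℕ<n w) (Fin.toℕ<n _) (w≢h j)
    (complement²-induced⇒ h-inj (λ x y → cycleAdj? k (toℕ x) (toℕ y)) adj)

lemma3p1 : (k : ℕ) → 5 ≤ k →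
    ¬ Is2Cograph (complement (cycle k)) ×
    (∀ (m : ℕ) (f : Fin m → Fin k) → Injective _≡_ _≡_ f → m < k →
      Is2Cograph (induced (complement (cycle k)) f))
lemma3p1 (suc (suc (suc (suc (suc n))))) (s≤s (s≤s (s≤s (s≤s (s≤s z≤n))))) =
  (λ is-2-cograph → is-2-cograph _ id id (coCycle-TwoConnected n , complement²-cycle-TwoConnected)) ,
  λ m f f-inj m<k m′ g g-inj (_ , co-2-connected) →
    let w , missed = injection-misses f f-inj m<k
    in complement-induced-coCycle-¬TwoConnected (f ∘ g) (g-inj ∘ f-inj) w (missed ∘ g) co-2-connected
  where
  complement²-cycle-TwoConnected : TwoConnected (complement (complement (cycle (5 + n))))
  complement²-cycle-TwoConnected =
    TwoConnected-mono (⊆-complement² {G = cycle (5 + n)} cycleAdj-irrefl) (cycle-TwoConnected (2 + n))
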